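{- For all positive integers $k,c$ there is a number $f(k,c)$ such that for every $n\ge f(k,c)$, every $c$-coloring of the nodes of the perfect $k$-ary tree of height $n$ is 1-balanced, i.e. there exist a node $r$, an integer $j\ge 0$ and strings $s_1,\ldots,s_k\in[k]^j$ such that the nodes $r,\ r\cdot 1\cdot s_1,\ \ldots,\ r\cdot k\cdot s_k$ all lie in the tree and all have the same color.
   Context: For a positive integer $k$, strings are finite sequences over $[k]=\{1,\ldots,k\}$, $s\cdot t$ denotes concatenation, and $[k]^j$ is the set of strings of length $j$. The perfect $k$-ary tree of height $n$ is the set of all strings over $[k]$ of length between $0$ and $n$; its nodes are these strings. -}

module Defs where

open import Data.Nat using (ℕ; _≤_)
open import Data.Fin using (Fin)
open import Data.List using (List; length; _++_; _∷_)
open import Data.Vec using (Vec; toList)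
open import Data.Product using (Σ; Σ-syntax; _×_; _,_)
open import Relation.Binary.PropositionalEquality using (_≡_)

Str : ℕ → Set
Str k = List (Fin k)

Node : ℕ → ℕ → Set
Node k n = Σ[ s ∈ Str k ] (length s ≤ n)

Coloring : ℕ → ℕ → ℕ → Set
Coloring k c n = Node k n → Fin c

OneBalanced : (k c n : ℕ) → Coloring k c n → Set
OneBalanced k c n χ =
  Σ[ r ∈ Str k ] Σ[ hr ∈ length r ≤ n ] Σ[ j ∈ ℕ ] Σ[ s ∈ (Fin k → Vec (Fin k) j) ]
  Σ[ hs ∈ ((i : Fin k) → length (r ++ (i ∷ toList (s i))) ≤ n) ]
  ((i : Fin k) → χ (r ++ (i ∷ toList (s i)) , hs i) ≡ χ (r , hr))

-- Induction on the number of colours. Suppose the nodes below v at the depths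
-- d₀ < d₁ < … < dₘ use at most c colours, and let r be a node below v at depth
-- d₀, of colour a. If for some j ≥ 1 every child r·i has a descendant at depth dⱼ
-- of colour a, then r is balanced. Otherwise each such dⱼ has a child i of r none
-- of whose descendants at depth dⱼ has colour a; by pigeonhole one child i is
-- chosen for bound(c − 1) + 1 of the depths, and below r·i at those depths only
-- c − 1 colours occur. So more than bound(c) depths suffice, where bound(0) = 0
-- and bound(c + 1) = k·bound(c) + 1.
module Submission where

open import Defs
open import Data.Nat using (ℕ; zero; suc; _≤_; _<_; _+_; _*_; _∸_; z≤n; s≤s; _<?_; _≤?_)
open import Data.Nat.Properties
open import Algebra.Properties.Monoid.Sum +-0-monoid using (sum)
open import Data.Fin using (Fin; zero; suc; punchIn; punchOut)
import Data.Fin as Fin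
open import Data.Fin.Properties using (any?; all?; ¬∀⟶∃¬; punchIn-punchOut)
open import Data.List using (List; []; _∷_; _∷ʳ_; length; _++_; replicate; filter; upTo)
open import Data.List.Properties using (length-++; ++-assoc; ∷ʳ-++; length-replicate; length-upTo)
open import Data.List.Relation.Unary.All using (All; []; _∷_; lookup; lookupAny; zip)
import Data.List.Relation.Unary.All.Properties as All
open import Data.List.Relation.Unary.Any using (here)
import Data.List.Relation.Unary.Any as Any
open import Data.List.Relation.Unary.AllPairs using (AllPairs; []; _∷_)
import Data.List.Relation.Unary.AllPairs.Properties as AllPairs
open import Data.List.Membership.Propositional using (_∈_)
open import Data.List.Membership.Propositional.Properties using (∈-filter⁻)
open import Data.List.Relation.Binary.Subset.Propositional using (_⊆_)
open import Data.List.Relation.Binary.Subset.Propositional.Properties using (xs⊆x∷xs; filter-⊆)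
open import Data.Vec using (Vec; toList; fromList) renaming ([] to []ᵥ; _∷_ to _∷ᵥ_)
open import Data.Vec.Properties using (length-toList; toList∘fromList)
open import Data.Product using (Σ-syntax; ∃; ∃-syntax; _×_; _,_; proj₁; proj₂)
import Data.Product as Product
open import Function using (_∘_; id)
open import Relation.Nullary using (Dec; yes; no; ¬_; contradiction)
import Relation.Nullary.Decidable as Dec
open import Relation.Unary using (Decidable)
open import Relation.Binary.PropositionalEquality

sum-mono-≤ : ∀ {k} {f g : Fin k → ℕ} → (∀ i → f i ≤ g i) → sum f ≤ sum g
sum-mono-≤ {zero}  f≤g = z≤n
sum-mono-≤ {suc k} f≤g = +-mono-≤ (f≤g zero) (sum-mono-≤ (f≤g ∘ suc))

sum-mono-< : ∀ {k} {f g : Fin k → ℕ} → (∀ i → f i ≤ g i) → ∀ j → f j < g j → sum f < sum g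
sum-mono-< {suc k} f≤g zero    fj<gj = +-mono-<-≤ fj<gj (sum-mono-≤ (f≤g ∘ suc))
sum-mono-< {suc k} f≤g (suc j) fj<gj = +-mono-≤-< (f≤g zero) (sum-mono-< (f≤g ∘ suc) j fj<gj)

sum-pigeonhole : ∀ {k} h (f : Fin k → ℕ) → k * h < sum f → ∃[ i ] h < f i
sum-pigeonhole {suc k} h f kh<sum with h <? f zero
... | yes h<f₀ = zero , h<f₀
... | no  h≮f₀ = Product.map suc id (sum-pigeonhole h (f ∘ suc) kh<rest)
  where
  kh<rest : k * h < sum (f ∘ suc)
  kh<rest = ≰⇒> λ rest≤kh → <⇒≱ kh<sum (+-mono-≤ (≮⇒≥ h≮f₀) rest≤kh)

module _ {A : Set} {k : ℕ} (label : A → Fin k) where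

  count : List A → Fin k → ℕ
  count xs i = length (filter (λ x → label x Fin.≟ i) xs)

  count-∷-≤ : ∀ x xs i → count xs i ≤ count (x ∷ xs) i
  count-∷-≤ x xs i with label x Fin.≟ i
  ... | yes _ = n≤1+n _
  ... | no  _ = ≤-refl

  count-∷-< : ∀ x xs → count xs (label x) < count (x ∷ xs) (label x)
  count-∷-< x xs with label x Fin.≟ label x
  ... | yes _  = ≤-refl
  ... | no  ≢x = contradiction refl ≢x

  length≤sum-count : ∀ xs → length xs ≤ sum (count xs)
  length≤sum-count []       = z≤n
  length≤sum-count (x ∷ xs) =
    ≤-trans (s≤s (length≤sum-count xs)) (sum-mono-< (count-∷-≤ x xs) (label x) (count-∷-< x xs))

  pigeonhole : ∀ h xs → k * h < length xs → ∃[ i ] h < count xs i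
  pigeonhole h xs kh<len = sum-pigeonhole h (count xs) (<-≤-trans kh<len (length≤sum-count xs))

any?-Vec : ∀ {k ℓ} {P : Vec (Fin k) ℓ → Set} → Decidable P → Dec (∃ P)
any?-Vec {ℓ = zero}  P? = Dec.map′ ([]ᵥ ,_) (λ { ([]ᵥ , p) → p }) (P? []ᵥ)
any?-Vec {ℓ = suc ℓ} P? =
  Dec.map′ (λ (x , s , p) → x ∷ᵥ s , p) (λ { (x ∷ᵥ s , p) → x , s , p })
           (any? λ x → any?-Vec (P? ∘ (x ∷ᵥ_)))

toVec : ∀ {A : Set} {ℓ} (w : List A) → length w ≡ ℓ → Σ[ s ∈ Vec A ℓ ] toList s ≡ w
toVec w refl = fromList w , toList∘fromList w

length-++-∷ : ∀ {A : Set} (r : List A) x w → length (r ++ x ∷ w) ≡ suc (length r + length w)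
length-++-∷ r x w = trans (length-++ r) (+-suc (length r) (length w))

length-++-∷⁻ : ∀ {A : Set} (r : List A) {x} w {e} → length (r ++ x ∷ w) ≡ e → length w ≡ e ∸ suc (length r)
length-++-∷⁻ r {x} w refl = begin
  length w                                          ≡⟨ m+n∸m≡n (suc (length r)) (length w) ⟨
  suc (length r + length w) ∸ suc (length r)        ≡⟨ cong (_∸ suc (length r)) (length-++-∷ r x w) ⟨
  length (r ++ x ∷ w) ∸ suc (length r)              ∎
  where open ≡-Reasoning

length-∷ʳ : ∀ {A : Set} (xs : List A) x → length (xs ∷ʳ x) ≡ suc (length xs)
length-∷ʳ xs x = trans (length-++ xs) (+-comm (length xs) 1)

length-++-∷⁺ : ∀ {A : Set} (r : List A) {x} w {e} → length r < e → length w ≡ e ∸ suc (length r) →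
  length (r ++ x ∷ w) ≡ e
length-++-∷⁺ r {x} w {e} r<e |w|≡ = begin
  length (r ++ x ∷ w)                    ≡⟨ length-++-∷ r x w ⟩
  suc (length r) + length w              ≡⟨ cong (suc (length r) +_) |w|≡ ⟩
  suc (length r) + (e ∸ suc (length r))  ≡⟨ m+[n∸m]≡n r<e ⟩
  e                                      ∎
  where open ≡-Reasoning

padding : ∀ {A : Set} (x : A) v {d} → length v ≤ d → ∃[ u ] length (v ++ u) ≡ d
padding x v {d} v≤d = replicate (d ∸ length v) x ,
  trans (length-++ v) (trans (cong (length v +_) (length-replicate _)) (m+[n∸m]≡n v≤d))

bound : ℕ → ℕ → ℕ
bound k zero    = 0
bound k (suc c) = suc (k * bound k c)

module TotalColouring {k C : ℕ} (n : ℕ) (χ : Str (suc k) → Fin C) where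

  ChildMatches : Str (suc k) → ℕ → Fin (suc k) → Set
  ChildMatches r e i = Σ[ s ∈ Vec (Fin (suc k)) (e ∸ suc (length r)) ] χ (r ++ i ∷ toList s) ≡ χ r

  BalancedAt : Str (suc k) → ℕ → Set
  BalancedAt r e = ∀ i → ChildMatches r e i

  childMatches? : ∀ r e → Decidable (ChildMatches r e)
  childMatches? r e i = any?-Vec (λ s → χ (r ++ i ∷ toList s) Fin.≟ χ r)

  balancedAt? : ∀ r → Decidable (BalancedAt r)
  balancedAt? r e = all? (childMatches? r e)

  Balanced : Set
  Balanced = Σ[ r ∈ Str (suc k) ] Σ[ e ∈ ℕ ] length r < e × e ≤ n × BalancedAt r e

  missingChild : Str (suc k) → ℕ → Fin (suc k)
  missingChild r e with balancedAt? r e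
  ... | yes _   = zero
  ... | no  ¬bal = proj₁ (¬∀⟶∃¬ _ _ (childMatches? r e) ¬bal)

  missingChild-missing : ∀ r e → ¬ BalancedAt r e → ¬ ChildMatches r e (missingChild r e)
  missingChild-missing r e ¬bal with balancedAt? r e
  ... | yes bal  = contradiction bal ¬bal
  ... | no  ¬bal′ = proj₂ (¬∀⟶∃¬ _ _ (childMatches? r e) ¬bal′)

  missingDepths : Str (suc k) → Fin (suc k) → List ℕ → List ℕ
  missingDepths r i = filter (λ e → missingChild r e Fin.≟ i)

  ¬ChildMatches⇒≢ : ∀ {r e i} w → ¬ ChildMatches r e i → length (r ++ i ∷ w) ≡ e → χ (r ++ i ∷ w) ≢ χ r
  ¬ChildMatches⇒≢ {r} w ¬match len≡e χ≡ with toVec w (length-++-∷⁻ r w len≡e)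
  ... | s , refl = ¬match (s , χ≡)

  Palette : ∀ {c} → (Fin c → Fin C) → Str (suc k) → List ℕ → Set
  Palette ι v L = ∀ w → length (v ++ w) ∈ L → ∃[ a ] χ (v ++ w) ≡ ι a

  Palette-⊆ : ∀ {c} {ι : Fin c → Fin C} {v L L′} → L′ ⊆ L → Palette ι v L → Palette ι v L′
  Palette-⊆ L′⊆L pal w ∈L′ = pal w (L′⊆L ∈L′)

  Palette-++ : ∀ {c} {ι : Fin c → Fin C} {v L} u → Palette ι v L → Palette ι (v ++ u) L
  Palette-++ {v = v} u pal w rewrite ++-assoc v u w = pal (u ++ w)

  Palette-punchIn : ∀ {c} {ι : Fin (suc c) → Fin C} {v L} a →
    (∀ w → length (v ++ w) ∈ L → χ (v ++ w) ≢ ι a) → Palette ι v L → Palette (ι ∘ punchIn a) v L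
  Palette-punchIn {ι = ι} a avoids pal w ∈L with pal w ∈L
  ... | b , χ≡ιb = punchOut a≢b , trans χ≡ιb (cong ι (sym (punchIn-punchOut a≢b)))
    where
    a≢b : a ≢ b
    a≢b refl = avoids w ∈L χ≡ιb

  Palette-child : ∀ {c} {ι : Fin (suc c) → Fin C} {r L a} i → χ r ≡ ι a → All (¬_ ∘ BalancedAt r) L →
    Palette ι r L → Palette (ι ∘ punchIn a) (r ∷ʳ i) (missingDepths r i L)
  Palette-child {ι = ι} {r} {L} {a} i χr≡ιa unbalanced pal =
    Palette-punchIn a avoids (Palette-⊆ (filter-⊆ _ L) (Palette-++ (i ∷ []) pal))
    where
    avoids : ∀ w → length (r ∷ʳ i ++ w) ∈ missingDepths r i L → χ (r ∷ʳ i ++ w) ≢ ι a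
    avoids w ∈L′ χ≡ιa with ∈-filter⁻ (λ e → missingChild r e Fin.≟ i) ∈L′
    ... | ∈L , missing≡i = ¬ChildMatches⇒≢ w ¬match (cong length (sym r∷ʳi++w))
      (trans (cong χ (sym r∷ʳi++w)) (trans χ≡ιa (sym χr≡ιa)))
      where
      r∷ʳi++w : r ∷ʳ i ++ w ≡ r ++ i ∷ w
      r∷ʳi++w = ∷ʳ-++ r i w
      ¬match : ¬ ChildMatches r (length (r ∷ʳ i ++ w)) i
      ¬match = subst (¬_ ∘ ChildMatches r (length (r ∷ʳ i ++ w))) missing≡i
        (missingChild-missing r (length (r ∷ʳ i ++ w)) (lookup unbalanced ∈L))

  balanced : ∀ c (ι : Fin c → Fin C) v L → AllPairs _<_ L → All (length v ≤_) L → All (_≤ n) L →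
    bound (suc k) c < length L → Palette ι v L → Balanced

  balancedFrom : ∀ c (ι : Fin c → Fin C) r L → AllPairs _<_ L → All (length r <_) L → All (_≤ n) L →
    bound (suc k) c ≤ length L → ∃[ a ] χ r ≡ ι a → Palette ι r L → Balanced

  balanced c ι v (d ∷ L) (d<L ∷ sorted) (v≤d ∷ _) (_ ∷ L≤n) (s≤s bound≤|L|) pal
    with u , refl ← padding zero v v≤d
    = balancedFrom c ι (v ++ u) L sorted d<L L≤n bound≤|L| (pal u (here refl))
        (Palette-⊆ (xs⊆x∷xs L _) (Palette-++ u pal))

  balancedFrom zero    ι r L _ _ _ _ (() , _) _
  balancedFrom (suc c) ι r L sorted r<L L≤n bound≤|L| (a , χr≡ιa) pal with Any.any? (balancedAt? r) L
  ... | yes found =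
    let (r<e , e≤n) , bal = lookupAny (zip (r<L , L≤n)) found
    in r , Any.lookup found , r<e , e≤n , bal
  ... | no none with i , many ← pigeonhole (missingChild r) (bound (suc k) c) L bound≤|L| =
    balanced c (ι ∘ punchIn a) (r ∷ʳ i) (missingDepths r i L)
      (AllPairs.filter⁺ _ sorted) (All.filter⁺ _ (subst (λ m → All (m ≤_) L) (sym (length-∷ʳ r i)) r<L))
      (All.filter⁺ _ L≤n) many (Palette-child i χr≡ιa (All.¬Any⇒All¬ L none) pal)

  balanced-tree : bound (suc k) C ≤ n → Balanced
  balanced-tree bound≤n =
    balanced C id [] (upTo (suc n))
      (AllPairs.applyUpTo⁺₁ id (suc n) (λ i<j _ → i<j))
      (All.applyUpTo⁺₂ id (suc n) (λ _ → z≤n))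
      (All.applyUpTo⁺₁ id (suc n) ≤-pred)
      (subst (bound (suc k) C <_) (sym (length-upTo (suc n))) (s≤s bound≤n))
      (λ w _ → χ w , refl)

-- Nodes outside the tree get colour zero, which needs c ≥ 1.
extend : ∀ {k c} n → Coloring k (suc c) n → Str k → Fin (suc c)
extend n χ w with length w ≤? n
... | yes w≤n = χ (w , w≤n)
... | no  _   = zero

extend-node : ∀ {k c} n (χ : Coloring k (suc c) n) w (w≤n : length w ≤ n) → extend n χ w ≡ χ (w , w≤n)
extend-node n χ w w≤n with length w ≤? n
... | yes w≤n′ = cong (λ p → χ (w , p)) (≤-irrelevant w≤n′ w≤n)
... | no  w≰n  = contradiction w≤n w≰n

balanced⇒OneBalanced : ∀ {k c} n (χ : Coloring (suc k) (suc c) n) →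
  TotalColouring.Balanced n (extend n χ) → OneBalanced (suc k) (suc c) n χ
balanced⇒OneBalanced n χ (r , e , r<e , e≤n , bal) =
  r , r≤n , e ∸ suc (length r) , proj₁ ∘ bal , child≤n , λ i →
    trans (sym (extend-node n χ _ (child≤n i))) (trans (proj₂ (bal i)) (extend-node n χ r r≤n))
  where
  r≤n : length r ≤ n
  r≤n = <⇒≤ (<-≤-trans r<e e≤n)
  child≤n : ∀ i → length (r ++ i ∷ toList (proj₁ (bal i))) ≤ n
  child≤n i = subst (_≤ n) (sym (length-++-∷⁺ r (toList s) r<e (length-toList s))) e≤n
    where s = proj₁ (bal i)

lemma2 : (k c : ℕ) → 1 ≤ k → 1 ≤ c →
    Σ[ f ∈ ℕ ] ((n : ℕ) → f ≤ n → (χ : Coloring k c n) → OneBalanced k c n χ)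
lemma2 (suc k) (suc c) _ _ = bound (suc k) (suc c) , λ n bound≤n χ →
  balanced⇒OneBalanced n χ (TotalColouring.balanced-tree n (extend n χ) bound≤n)
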